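{- Let $m\ge 2$ be even and $n\ge 1$. Run Algorithm EVEN (described in the context) with $n$ disks and $m+1$ pegs, and record the digit tuple $(a_n,\dots,a_1)$ after initialization and after every single-step move of any disk. Then the sequence of recorded tuples is exactly the $m$-ary reflected Gray code $G_n$ of length $n$.
   Context: Disks $D_1,\dots,D_n$ have increasing sizes; pegs $P_0,\dots,P_m$ are arranged in a cyclic clockwise order; a clockwise step moves a disk from $P_i$ to $P_{(i+1)\bmod (m+1)}$ and a counterclockwise step from $P_i$ to $P_{(i-1)\bmod(m+1)}$, putting it on top of the target stack. Disks $D_i$ with odd $i$ always move clockwise, disks with even $i$ always counterclockwise. Algorithm EVEN: Initially all disks are on $P_0$ and all digits $a_i=0$. Repeat: (i) move $D_1$ for $m-1$ single clockwise steps; (ii) among the topmost disks of the $m$ pegs that do not carry $D_1$, let $D_k$ be the smallest; if there is none, terminate; (iii) move $D_k$ one step in the direction determined by the parity of $k$. Every time disk $D_i$ is moved, the digit $a_i$ advances to the next value of the periodic sequence $0,1,2,\dots,m-2,m-1,m-2,\dots,2,1,0,1,2,\dots$. The $m$-ary reflected Gray code $G_n$ is a sequence of $n$-tuples $(a_n,\dots,a_1)$, $0\le a_i<m$, defined recursively: $G_0$ consists of the empty tuple; if $G_n=C_1,\dots,C_{m^n}$, then $G_{n+1}$ lists, for $i=1,\dots,m^n$ in order, the tuples $C_ix$ with $x$ running $0,1,\dots,m-1$ if $i$ is odd and $x$ running $m-1,\dots,1,0$ if $i$ is even; here $C_ix$ is the tuple whose digits $(a_{n+1},\dots,a_2)$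 are those of $C_i$ and whose last digit $a_1$ is $x$. -}

module Defs where

open import Data.Nat using (ℕ; zero; suc; _+_; _∸_; _≡ᵇ_; _<ᵇ_)
open import Data.Nat.DivMod using (_%_; m%n<n)
open import Data.Bool using (Bool; true; false; not; if_then_else_)
open import Data.List using (List; []; _∷_; _++_; [_]; map; reverse; upTo; applyUpTo; replicate; filterᵇ; foldr)
open import Data.Bool.ListAction using (any)
open import Data.Vec as V using (Vec; _∷_; []; updateAt)
open import Data.Fin using (Fin; toℕ; fromℕ<) renaming (zero to fz; suc to fs)
open import Data.Maybe as M using (Maybe; just; nothing)
open import Data.Product using (_×_; _,_; proj₁; proj₂)

-- m-ary reflected Gray code G_n.
-- A tuple (a_n , … , a_1) is the list [a_n , … , a_1] (a_1 last).

grayStep : ℕ → Bool → List (List ℕ) → List (List ℕ)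
grayStep m b []       = []
grayStep m b (c ∷ cs) =
  map (λ x → c ++ [ x ]) (if b then upTo m else reverse (upTo m))
  ++ grayStep m (not b) cs

-- i = 1 (odd) gets ascending digits, i = 2 descending, …
G : ℕ → ℕ → List (List ℕ)
G m zero    = [] ∷ []
G m (suc n) = grayStep m true (G m n)

cw : (m : ℕ) → Fin (suc m) → Fin (suc m)
cw m i = fromℕ< (m%n<n (suc (toℕ i)) (suc m))

ccw : (m : ℕ) → Fin (suc m) → Fin (suc m)
ccw m i = fromℕ< (m%n<n (toℕ i + m) (suc m))

isOdd : ℕ → Bool
isOdd zero    = false
isOdd (suc n) = not (isOdd n)

dir : (m : ℕ) → ℕ → Fin (suc m) → Fin (suc m)
dir m i p = if isOdd i then cw m p else ccw m p

-- Digits: a digit state is (current value , going-up?), walking the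
-- periodic sequence 0,1,…,m-2,m-1,m-2,…,1,0,1,…

nextDigit : ℕ → ℕ × Bool → ℕ × Bool
nextDigit m (a , true)  = if suc a ≡ᵇ (m ∸ 1) then (suc a , false) else (suc a , true)
nextDigit m (a , false) = if a ≡ᵇ 1 then (0 , true) else (a ∸ 1 , false)

-- State: stacks on the pegs (head of a list = top of the stack, disks
-- named by 1 … n), and digit states (list position i-1 = disk D_i).

record State (m : ℕ) : Set where
  constructor st
  field
    pegs : Vec (List ℕ) (suc m)
    digs : List (ℕ × Bool)
open State public

mem : ℕ → List ℕ → Bool
mem i = any (λ x → x ≡ᵇ i)

removeDisk : ℕ → List ℕ → List ℕ
removeDisk i = filterᵇ (λ x → not (x ≡ᵇ i))

findPeg : ∀ {k} → Vec (List ℕ) k → ℕ → Maybe (Fin k)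
findPeg []       i = nothing
findPeg (s ∷ ss) i = if mem i s then just fz else M.map fs (findPeg ss i)

modifyAt : {A : Set} → ℕ → (A → A) → List A → List A
modifyAt i       f []       = []
modifyAt zero    f (x ∷ xs) = f x ∷ xs
modifyAt (suc i) f (x ∷ xs) = x ∷ modifyAt i f xs

moveDisk : (m : ℕ) → ℕ → State m → State m
moveDisk m i s with findPeg (pegs s) i
... | nothing = s
... | just p  =
  st (updateAt (updateAt (pegs s) p (removeDisk i)) (dir m i p) (i ∷_))
     (modifyAt (i ∸ 1) (nextDigit m) (digs s))

tuple : ∀ {m} → State m → List ℕ
tuple s = reverse (map proj₁ (digs s))

moveD1s : (m : ℕ) → ℕ → State m → List (List ℕ) × State m
moveD1s m zero    s = [] , s
moveD1s m (suc k) s =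
  let s1 = moveDisk m 1 s
      r  = moveD1s m k s1
  in (tuple s1 ∷ proj₁ r) , proj₂ r

minM : List ℕ → Maybe ℕ
minM []       = nothing
minM (x ∷ xs) with minM xs
... | nothing = just x
... | just y  = just (if x <ᵇ y then x else y)

topNoD1 : List ℕ → List ℕ
topNoD1 []       = []
topNoD1 (d ∷ ds) = if mem 1 (d ∷ ds) then [] else [ d ]

smallestTop : ∀ {m} → State m → Maybe ℕ
smallestTop s = minM (V.foldr (λ _ → List ℕ) (λ t acc → topNoD1 t ++ acc) [] (pegs s))

-- runs at most `fuel` iterations of the main loop; `just ts` if the
-- algorithm terminated, ts = tuples recorded from this point on.
runEVEN : (m : ℕ) → ℕ → State m → Maybe (List (List ℕ))
runEVEN m zero       s = nothing
runEVEN m (suc fuel) s with moveD1s m (m ∸ 1) s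
... | (rec , s1) with smallestTop s1
...   | nothing = just rec
...   | just k  = let s2 = moveDisk m k s1 in
                  M.map (λ rest → rec ++ (tuple s2 ∷ rest)) (runEVEN m fuel s2)

initState : (m n : ℕ) → State m
initState m n = st (applyUpTo suc n ∷ V.replicate m []) (replicate n (0 , true))

traceEVEN : (m n fuel : ℕ) → Maybe (List (List ℕ))
traceEVEN m n fuel = M.map (tuple (initState m n) ∷_) (runEVEN m fuel (initState m n))

-- Every state of the run is determined by its move counts (c₁,…,cₙ): disk Dᵢ
-- lies on peg cᵢ (i odd) or −cᵢ (i even) modulo m+1, pegs hold their disks in
-- increasing order, and aᵢ is the cᵢ-th term of the zig-zag sequence 0,…,m−1,…,0.
--  * `move-config`: a move of D_k increments c_k, if no smaller disk lies on
--    its target peg;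
--  * `counts-step`: after t moves cᵢ = ⌊t/mⁱ⁻¹⌋ − ⌊t/mⁱ⌋, and t ↦ t+1 increments
--    c_k with k−1 the number of trailing base-m digits m−1 of t; then
--    D₁,…,D_{k−1} form a tower avoided by D_k (`tower-below`), so D_k is the
--    selected disk (`smallestTop-config`); at t = mⁿ−1 none is (`smallestTop-finished`);
--  * `gray-tuples`: the tuple after t moves is the t-th word of Gₙ.
-- The theorem follows by running mⁿ⁻¹ rounds of the main loop (`run-rounds`).
module Submission where

open import Defs
open import Data.Nat using (ℕ; zero; suc; _+_; _*_; _∸_; _^_; _≤_; _<_; z≤n; s≤s; s≤s⁻¹; pred; _≡ᵇ_; _<ᵇ_; _<?_; _≟_)
open import Data.Nat.Properties
open import Data.Nat.DivMod
open import Data.Nat.Divisibility using (_∣_; n∣m*n; m%n≡0⇒n∣m)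
open import Data.Nat.GeneralisedArithmetic using (fold; fold-+)
open import Data.Nat.Tactic.RingSolver using (solve-∀)
open import Data.Bool using (Bool; true; false; not; if_then_else_; T)
open import Data.List using (List; []; _∷_; _++_; [_]; map; reverse; upTo; applyUpTo; replicate; length)
open import Data.List.Properties using (map-id; reverse-++; map-++; unfold-reverse; map-∘)
open import Data.List.Membership.Propositional using (_∈_)
open import Data.List.Relation.Unary.All as All using (All; []; _∷_)
import Data.List.Relation.Unary.All.Properties as All
open import Data.List.Relation.Unary.Any using (here; there)
import Data.List.Relation.Unary.Any.Properties as Any
open import Data.Vec as V using (Vec; _∷_; []; updateAt; tabulate)
open import Data.Vec.Properties using (tabulate-cong)
open import Data.Fin using (Fin; toℕ; fromℕ<) renaming (zero to fz; suc to fs)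
open import Data.Fin.Properties using (toℕ-fromℕ<; toℕ-injective)
open import Data.Maybe as M using (just; nothing)
open import Data.Product using (_×_; _,_; proj₁; proj₂; ∃-syntax)
open import Data.Unit using (⊤; tt)
open import Data.Empty using (⊥-elim)
open import Relation.Nullary using (yes; no)
open import Relation.Binary.PropositionalEquality hiding ([_])
open import Function using (_∘_)

≡ᵇ-true : ∀ a b → a ≡ b → (a ≡ᵇ b) ≡ true
≡ᵇ-true a b e with a ≡ᵇ b | ≡⇒≡ᵇ a b e
... | true | _ = refl

≡ᵇ-false : ∀ a b → a ≢ b → (a ≡ᵇ b) ≡ false
≡ᵇ-false a b ne with a ≡ᵇ b in eq
... | false = refl
... | true  = ⊥-elim (ne (≡ᵇ⇒≡ a b (subst T (sym eq) tt)))

removeDisk-absent : ∀ d l → All (d <_) l → removeDisk d l ≡ l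
removeDisk-absent d []      _        = refl
removeDisk-absent d (y ∷ l) (p ∷ ps)
  rewrite ≡ᵇ-false y d (λ e → <-irrefl (sym e) p) = cong (y ∷_) (removeDisk-absent d l ps)

mem-absent : ∀ d l → All (d <_) l → mem d l ≡ false
mem-absent d []      _        = refl
mem-absent d (y ∷ l) (p ∷ ps)
  rewrite ≡ᵇ-false y d (λ e → <-irrefl (sym e) p) = mem-absent d l ps

update : ∀ {L} {A : Set} → Fin L → (A → A) → (Fin L → A) → Fin L → A
update fz     f g fz     = f (g fz)
update fz     f g (fs j) = g (fs j)
update (fs i) f g fz     = g fz
update (fs i) f g (fs j) = update i f (g ∘ fs) j

updateAt-tabulate : ∀ {L} {A : Set} (i : Fin L) (f : A → A) (g : Fin L → A) →
                    updateAt (tabulate g) i f ≡ tabulate (update i f g)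
updateAt-tabulate fz     f g = refl
updateAt-tabulate (fs i) f g = cong (g fz ∷_) (updateAt-tabulate i f (g ∘ fs))

update-same : ∀ {L} {A : Set} (i : Fin L) (f : A → A) (g : Fin L → A) → update i f g i ≡ f (g i)
update-same fz     f g = refl
update-same (fs i) f g = update-same i f (g ∘ fs)

update-other : ∀ {L} {A : Set} (i j : Fin L) (f : A → A) (g : Fin L → A) → i ≢ j → update i f g j ≡ g j
update-other fz     fz     f g ne = ⊥-elim (ne refl)
update-other fz     (fs j) f g ne = refl
update-other (fs i) fz     f g ne = refl
update-other (fs i) (fs j) f g ne = update-other i j f (g ∘ fs) (λ e → ne (cong fs e))

tabulate-constant : ∀ {L} {A : Set} (x : A) (g : Fin L → A) → (∀ p → g p ≡ x) → tabulate g ≡ V.replicate L x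
tabulate-constant {zero}  x g h = refl
tabulate-constant {suc L} x g h = cong₂ _∷_ (h fz) (tabulate-constant x (g ∘ fs) (h ∘ fs))

findPeg-tabulate : ∀ {L} (g : Fin L → List ℕ) d X (X<L : X < L) →
                   (∀ p → mem d (g p) ≡ (X ≡ᵇ toℕ p)) → findPeg (tabulate g) d ≡ just (fromℕ< X<L)
findPeg-tabulate {suc L} g d zero    X<L       h rewrite h fz = refl
findPeg-tabulate {suc L} g d (suc X) (s≤s X<L) h
  rewrite h fz | findPeg-tabulate (g ∘ fs) d X X<L (h ∘ fs) = refl

moveDisk-found : ∀ m (s : State m) i p → findPeg (pegs s) i ≡ just p →
  moveDisk m i s ≡ st (updateAt (updateAt (pegs s) p (removeDisk i)) (dir m i p) (i ∷_))
                      (modifyAt (i ∸ 1) (nextDigit m) (digs s))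
moveDisk-found m s i p eq with findPeg (pegs s) i
moveDisk-found m s i p refl | .(just p) = refl

tops : ∀ {L} → Vec (List ℕ) L → List ℕ
tops = V.foldr (λ _ → List ℕ) (λ t acc → topNoD1 t ++ acc) []

tops-All : ∀ {L} (g : Fin L → List ℕ) (P : ℕ → Set) →
           (∀ p → All P (topNoD1 (g p))) → All P (tops (tabulate g))
tops-All {zero}  g P h = []
tops-All {suc L} g P h = All.++⁺ (h fz) (tops-All (g ∘ fs) P (h ∘ fs))

tops-∈ : ∀ {L} (g : Fin L → List ℕ) k (p : Fin L) → k ∈ topNoD1 (g p) → k ∈ tops (tabulate g)
tops-∈ {suc L} g k fz     h = Any.++⁺ˡ h
tops-∈ {suc L} g k (fs p) h = Any.++⁺ʳ (topNoD1 (g fz)) (tops-∈ (g ∘ fs) k p h)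

tops-empty : ∀ {L} (g : Fin L → List ℕ) → (∀ p → topNoD1 (g p) ≡ []) → tops (tabulate g) ≡ []
tops-empty {zero}  g h = refl
tops-empty {suc L} g h rewrite h fz = tops-empty (g ∘ fs) (h ∘ fs)

topNoD1-D1 : ∀ l → mem 1 l ≡ true → topNoD1 l ≡ []
topNoD1-D1 []       _ = refl
topNoD1-D1 (d ∷ ds) e rewrite e = refl

topNoD1-All : ∀ (P : ℕ → Set) l → All P l → All P (topNoD1 l)
topNoD1-All P []       _       = []
topNoD1-All P (d ∷ ds) (p ∷ _) with mem 1 (d ∷ ds)
... | true  = []
... | false = p ∷ []

minM-cons : ∀ y ys → ∃[ z ] minM (y ∷ ys) ≡ just z
minM-cons y ys with minM ys
... | nothing = y , refl
... | just w  = _ , refl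

minM-∈ : ∀ L y → minM L ≡ just y → y ∈ L
minM-∈ (x ∷ xs) y eq with minM xs in e
minM-∈ (x ∷ xs) .x refl | nothing = here refl
... | just w with x <ᵇ w
minM-∈ (x ∷ xs) .x refl | just w | true  = here refl
minM-∈ (x ∷ xs) .w refl | just w | false = there (minM-∈ xs w e)

minM-least : ∀ L k → All (k ≤_) L → k ∈ L → minM L ≡ just k
minM-least (x ∷ xs) k (kx ∷ A) k∈ with minM xs in e
minM-least (x ∷ xs) k (kx ∷ A) (here refl) | nothing = refl
minM-least (x ∷ (y ∷ ys)) k (kx ∷ A) (there k∈) | nothing with minM-cons y ys
... | z , e2 with trans (sym e) e2
... | ()
minM-least (x ∷ xs) k (kx ∷ A) k∈ | just w with x <ᵇ w in ew | All.lookup A (minM-∈ xs w e)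
minM-least (x ∷ xs) k (kx ∷ A) (here refl) | just w | true  | kw = refl
minM-least (x ∷ xs) k (kx ∷ A) (here refl) | just w | false | kw =
  cong just (≤-antisym (≮⇒≥ (λ lt → subst T ew (<⇒<ᵇ lt))) kw)
minM-least (x ∷ xs) k (kx ∷ A) (there k∈) | just w | c | kw with trans (sym e) (minM-least xs k A k∈)
minM-least (x ∷ xs) k (kx ∷ A) (there k∈) | just .k | true  | kw | refl =
  ⊥-elim (<-irrefl refl (≤-trans (<ᵇ⇒< x k (subst T (sym ew) tt)) kx))
minM-least (x ∷ xs) k (kx ∷ A) (there k∈) | just .k | false | kw | refl = refl

runEVEN-stop : ∀ m fuel (s : State m) rec s1 → moveD1s m (m ∸ 1) s ≡ (rec , s1) →
               smallestTop s1 ≡ nothing → runEVEN m (suc fuel) s ≡ just rec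
runEVEN-stop m fuel s rec s1 e1 e2 with moveD1s m (m ∸ 1) s | e1
... | .(rec , s1) | refl with smallestTop s1 | e2
... | .nothing | refl = refl

runEVEN-step : ∀ m fuel (s : State m) rec s1 k → moveD1s m (m ∸ 1) s ≡ (rec , s1) → smallestTop s1 ≡ just k →
               runEVEN m (suc fuel) s
               ≡ M.map (λ rest → rec ++ (tuple (moveDisk m k s1) ∷ rest)) (runEVEN m fuel (moveDisk m k s1))
runEVEN-step m fuel s rec s1 k e1 e2 with moveD1s m (m ∸ 1) s | e1
... | .(rec , s1) | refl with smallestTop s1 | e2
... | .(just k) | refl = refl

range : ℕ → ℕ → List ℕ
range a zero    = []
range a (suc l) = a ∷ range (suc a) l

range-++ : ∀ a l₁ l₂ b → b ≡ a + l₁ → range a l₁ ++ range b l₂ ≡ range a (l₁ + l₂)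
range-++ a zero     l₂ b e rewrite e | +-identityʳ a = refl
range-++ a (suc l₁) l₂ b e = cong (a ∷_) (range-++ (suc a) l₁ l₂ b (trans e (+-suc a l₁)))

map-range-+ : ∀ {A : Set} (f : ℕ → A) a b l → map f (range (a + b) l) ≡ map (λ x → f (x + b)) (range a l)
map-range-+ f a b zero    = refl
map-range-+ f a b (suc l) = cong (f (a + b) ∷_) (map-range-+ f (suc a) b l)

map-range-suc : ∀ {A : Set} (f : ℕ → A) a l → map f (range (suc a) l) ≡ map (f ∘ suc) (range a l)
map-range-suc f a zero    = refl
map-range-suc f a (suc l) = cong (f (suc a) ∷_) (map-range-suc f (suc a) l)

applyUpTo-range : ∀ {A : Set} (f : ℕ → A) l → applyUpTo f l ≡ map f (range 0 l)
applyUpTo-range f zero    = refl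
applyUpTo-range f (suc l) = cong (f 0 ∷_) (trans (applyUpTo-range (f ∘ suc) l) (sym (map-range-suc f 0 l)))

upTo-range : ∀ l → upTo l ≡ range 0 l
upTo-range l = trans (applyUpTo-range (λ x → x) l) (map-id (range 0 l))

reverse-range : ∀ l → reverse (range 0 (suc l)) ≡ map (l ∸_) (range 0 (suc l))
reverse-range zero    = refl
reverse-range (suc l) = begin
    reverse (range 0 (suc (suc l)))
      ≡⟨ cong reverse (sym (trans (range-++ 0 (suc l) 1 (suc l) refl) (cong (range 0) (+-comm (suc l) 1)))) ⟩
    reverse (range 0 (suc l) ++ [ suc l ])   ≡⟨ reverse-++ (range 0 (suc l)) [ suc l ] ⟩
    suc l ∷ reverse (range 0 (suc l))         ≡⟨ cong (suc l ∷_) (reverse-range l) ⟩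
    suc l ∷ map (l ∸_) (range 0 (suc l))      ≡⟨ cong (suc l ∷_) (sym (map-range-suc (suc l ∸_) 0 (suc l))) ⟩
    map (suc l ∸_) (range 0 (suc (suc l)))    ∎
  where open ≡-Reasoning

nth : ℕ → List ℕ → ℕ
nth _       []       = 0
nth zero    (c ∷ _)  = c
nth (suc j) (_ ∷ cs) = nth j cs

-- Prefix P i j cs: the first j counts satisfy P, the r-th one (r ≥ 0)
-- being that of disk i + r.
Prefix : (ℕ → ℕ → Set) → ℕ → ℕ → List ℕ → Set
Prefix P i zero    cs       = ⊤
Prefix P i (suc j) []       = ⊤
Prefix P i (suc j) (c ∷ cs) = P i c × Prefix P (suc i) j cs

Prefix-map : ∀ {P Q : ℕ → ℕ → Set} → (∀ e c → P e c → Q e c) → ∀ i k cs → Prefix P i k cs → Prefix Q i k cs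
Prefix-map f i zero    cs       B       = tt
Prefix-map f i (suc k) []       B       = tt
Prefix-map f i (suc k) (c ∷ cs) (p , B) = f i c p , Prefix-map f (suc i) k cs B

module Pegs (m2 : ℕ) where
  m1 = suc m2
  m  = suc m1
  M  = suc m

  -- the peg of disk d after c moves: odd disks walk +1, even disks −1 = +m
  peg : ℕ → ℕ → ℕ
  peg d c = if isOdd d then c % M else (c * m) % M

  stack : ℕ → List ℕ → ℕ → List ℕ
  stack i []       x = []
  stack i (c ∷ cs) x = if peg i c ≡ᵇ x then i ∷ stack (suc i) cs x else stack (suc i) cs x

  digit : ℕ → ℕ × Bool
  digit c = fold (0 , true) (nextDigit m) c

  -- the state in which disk D_(r+1) has moved c_r times
  config : List ℕ → State m
  config cs = st (tabulate (λ p → stack 1 cs (toℕ p))) (map digit cs)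

  stack-≥ : ∀ i cs x → All (i ≤_) (stack i cs x)
  stack-≥ i []       x = []
  stack-≥ i (c ∷ cs) x with peg i c ≡ᵇ x
  ... | true  = ≤-refl ∷ All.map (≤-trans (n≤1+n i)) (stack-≥ (suc i) cs x)
  ... | false = All.map (≤-trans (n≤1+n i)) (stack-≥ (suc i) cs x)

  mem-stack : ∀ j i cs x d → d ≡ j + i → j < length cs → mem d (stack i cs x) ≡ (peg d (nth j cs) ≡ᵇ x)
  mem-stack zero i (c ∷ cs) x .i refl _ with peg i c ≡ᵇ x
  ... | true rewrite ≡ᵇ-true i i refl = refl
  ... | false = mem-absent i (stack (suc i) cs x) (stack-≥ (suc i) cs x)
  mem-stack (suc j) i (c ∷ cs) x d eq (s≤s lt) with peg i c ≡ᵇ x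
  ... | true rewrite ≡ᵇ-false i d (λ e → m≢1+n+m i (trans e eq)) = mem-stack j (suc i) cs x d (trans eq (sym (+-suc j i))) lt
  ... | false = mem-stack j (suc i) cs x d (trans eq (sym (+-suc j i))) lt

  peg-renumber : ∀ j i a {x} → peg (suc j + i) a ≢ x → peg (j + suc i) a ≢ x
  peg-renumber j i a {x} = subst (λ z → peg z a ≢ x) (sym (+-suc j i))

  stack-other : ∀ j i cs x → peg (j + i) (nth j cs) ≢ x → peg (j + i) (suc (nth j cs)) ≢ x →
                stack i (modifyAt j suc cs) x ≡ stack i cs x
  stack-other j       i []       x _  _  = refl
  stack-other zero    i (c ∷ cs) x n1 n2 rewrite ≡ᵇ-false _ _ n1 | ≡ᵇ-false _ _ n2 = refl
  stack-other (suc j) i (c ∷ cs) x n1 n2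
    rewrite stack-other j (suc i) cs x (peg-renumber j i (nth j cs) n1) (peg-renumber j i (suc (nth j cs)) n2) = refl

  stack-leave : ∀ j i cs x d → d ≡ j + i → j < length cs → peg d (nth j cs) ≡ x → peg d (suc (nth j cs)) ≢ x →
                removeDisk d (stack i cs x) ≡ stack i (modifyAt j suc cs) x
  stack-leave zero i (c ∷ cs) x .i refl _ e1 n2
    rewrite ≡ᵇ-true _ _ e1 | ≡ᵇ-false _ _ n2 | ≡ᵇ-true i i refl =
    removeDisk-absent i (stack (suc i) cs x) (stack-≥ (suc i) cs x)
  stack-leave (suc j) i (c ∷ cs) x d eq (s≤s lt) e1 n2 with peg i c ≡ᵇ x
  ... | true rewrite ≡ᵇ-false i d (λ e → m≢1+n+m i (trans e eq)) =
    cong (i ∷_) (stack-leave j (suc i) cs x d (trans eq (sym (+-suc j i))) lt e1 n2)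
  ... | false = stack-leave j (suc i) cs x d (trans eq (sym (+-suc j i))) lt e1 n2

  stack-enter : ∀ j i cs x d → d ≡ j + i → j < length cs → peg d (suc (nth j cs)) ≡ x → peg d (nth j cs) ≢ x →
                Prefix (λ e c → peg e c ≢ x) i j cs → stack i (modifyAt j suc cs) x ≡ d ∷ stack i cs x
  stack-enter zero i (c ∷ cs) x .i refl _ e1 n2 _ rewrite ≡ᵇ-true _ _ e1 | ≡ᵇ-false _ _ n2 = refl
  stack-enter (suc j) i (c ∷ cs) x d eq (s≤s lt) e1 n2 (ne , B) rewrite ≡ᵇ-false _ _ ne =
    stack-enter j (suc i) cs x d (trans eq (sym (+-suc j i))) lt e1 n2 B

  digits-modify : ∀ j cs → modifyAt j (nextDigit m) (map digit cs) ≡ map digit (modifyAt j suc cs)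
  digits-modify j       []       = refl
  digits-modify zero    (c ∷ cs) = refl
  digits-modify (suc j) (c ∷ cs) = cong (digit c ∷_) (digits-modify j cs)

  %-absorbˡ : ∀ a b → (a % M + b) % M ≡ (a + b) % M
  %-absorbˡ a b = begin
      (a % M + b) % M          ≡⟨ %-distribˡ-+ (a % M) b M ⟩
      (a % M % M + b % M) % M  ≡⟨ cong (λ z → (z + b % M) % M) (m%n%n≡m%n a M) ⟩
      (a % M + b % M) % M      ≡⟨ %-distribˡ-+ a b M ⟨
      (a + b) % M              ∎
    where open ≡-Reasoning

  peg-< : ∀ d c → peg d c < M
  peg-< d c with isOdd d
  ... | true  = m%n<n c M
  ... | false = m%n<n (c * m) M

  dir-peg : ∀ d c (P : Fin M) → toℕ P ≡ peg d c → toℕ (dir m d P) ≡ peg d (suc c)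
  dir-peg d c P e with isOdd d
  ... | true rewrite toℕ-fromℕ< (m%n<n (suc (toℕ P)) M) | e =
        trans (cong (_% M) (+-comm 1 (c % M))) (trans (%-absorbˡ c 1) (cong (_% M) (+-comm c 1)))
  ... | false rewrite toℕ-fromℕ< (m%n<n (toℕ P + m) M) | e =
        trans (%-absorbˡ (c * m) m) (cong (_% M) (+-comm (c * m) m))

  residue-shift : ∀ r t → r < M → 0 < t → t < M → (r + t) % M ≢ r
  residue-shift r t r<M 0<t t<M e with r + t <? M
  ... | yes r+t<M = <-irrefl refl (subst (0 <_) t≡0 0<t)
    where t≡0 : t ≡ 0
          t≡0 = +-cancelˡ-≡ r t 0 (trans (trans (sym (m<n⇒m%n≡m r+t<M)) e) (sym (+-identityʳ r)))
  ... | no r+t≮M = <-irrefl refl (subst (_< M) t≡M t<M)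
    where
      k = r + t ∸ M
      k+M : k + M ≡ r + t
      k+M = m∸n+n≡m (≮⇒≥ r+t≮M)
      k<M : k < M
      k<M = +-cancelʳ-< M k M (subst (_< M + M) (sym k+M) (+-mono-< r<M t<M))
      k≡r : k ≡ r
      k≡r = begin
          k            ≡⟨ m<n⇒m%n≡m k<M ⟨
          k % M        ≡⟨ [m+n]%n≡m%n k M ⟨
          (k + M) % M  ≡⟨ cong (_% M) k+M ⟩
          (r + t) % M  ≡⟨ e ⟩
          r            ∎
        where open ≡-Reasoning
      t≡M : t ≡ M
      t≡M = +-cancelˡ-≡ r t M (trans (sym k+M) (cong (_+ M) k≡r))

  peg-moves : ∀ d c → peg d (suc c) ≢ peg d c
  peg-moves d c with isOdd d
  ... | true  = λ e → residue-shift (c % M) 1 (m%n<n c M) (s≤s z≤n) (s≤s (s≤s z≤n))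
                        (trans (%-absorbˡ c 1) (trans (cong (_% M) (+-comm c 1)) e))
  ... | false = λ e → residue-shift ((c * m) % M) m (m%n<n (c * m) M) (s≤s z≤n) ≤-refl
                        (trans (%-absorbˡ (c * m) m) (trans (cong (_% M) (+-comm (c * m) m)) e))

  move-config : ∀ cs j → j < length cs →
                Prefix (λ e c → peg e c ≢ peg (suc j) (suc (nth j cs))) 1 j cs →
                moveDisk m (suc j) (config cs) ≡ config (modifyAt j suc cs)
  move-config cs j j<len smaller-off =
    trans (moveDisk-found m (config cs) d P found) (cong₂ st (tabulated pegwise) (digits-modify j cs))
    where
      d  = suc j
      c  = nth j cs
      X  = peg d c
      Y  = peg d (suc c)
      d≡ : d ≡ j + 1
      d≡ = +-comm 1 j
      g : Fin M → List ℕ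
      g p = stack 1 cs (toℕ p)
      cs' = modifyAt j suc cs
      P : Fin M
      P = fromℕ< (peg-< d c)
      P≡X : toℕ P ≡ X
      P≡X = toℕ-fromℕ< (peg-< d c)
      Q = dir m d P
      Q≡Y : toℕ Q ≡ Y
      Q≡Y = dir-peg d c P P≡X
      Y≢X : Y ≢ X
      Y≢X = peg-moves d c
      found : findPeg (tabulate g) d ≡ just P
      found = findPeg-tabulate g d X (peg-< d c) (λ p → mem-stack j 1 cs (toℕ p) d d≡ j<len)
      pegwise : ∀ p → update Q (d ∷_) (update P (removeDisk d) g) p ≡ stack 1 cs' (toℕ p)
      pegwise p with toℕ p ≟ Y
      ... | yes p≡Y rewrite toℕ-injective {i = p} {j = Q} (trans p≡Y (sym Q≡Y))
            | update-same Q (d ∷_) (update P (removeDisk d) g)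
            | update-other P Q (removeDisk d) g (λ e → Y≢X (trans (sym Q≡Y) (trans (cong toℕ (sym e)) P≡X)))
            | Q≡Y = sym (stack-enter j 1 cs Y d d≡ j<len refl (Y≢X ∘ sym) smaller-off)
      ... | no p≢Y rewrite update-other Q p (d ∷_) (update P (removeDisk d) g) (λ e → p≢Y (trans (cong toℕ (sym e)) Q≡Y))
            with toℕ p ≟ X
      ...   | yes p≡X rewrite toℕ-injective {i = p} {j = P} (trans p≡X (sym P≡X))
              | update-same P (removeDisk d) g | P≡X = stack-leave j 1 cs X d d≡ j<len refl Y≢X
      ...   | no p≢X rewrite update-other P p (removeDisk d) g (λ e → p≢X (trans (cong toℕ (sym e)) P≡X)) =
              sym (stack-other j 1 cs (toℕ p) (λ e → p≢X (sym (trans (cong (λ z → peg z c) d≡) e)))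
                                              (λ e → p≢Y (sym (trans (cong (λ z → peg z (suc c)) d≡) e))))
      tabulated : (∀ p → update Q (d ∷_) (update P (removeDisk d) g) p ≡ stack 1 cs' (toℕ p)) →
                  updateAt (updateAt (tabulate g) P (removeDisk d)) Q (d ∷_) ≡ tabulate (λ p → stack 1 cs' (toℕ p))
      tabulated pw rewrite updateAt-tabulate P (removeDisk d) g | updateAt-tabulate Q (d ∷_) (update P (removeDisk d) g) =
        tabulate-cong pw

module Selection (m2 : ℕ) where
  open Pegs m2

  Tower : ℕ → ℕ → ℕ → List ℕ → Set
  Tower X = Prefix (λ e c → peg e c ≡ X)

  stack-beyond : ∀ X k i cs x → Tower X i k cs → x ≢ X → All (k + i ≤_) (stack i cs x)
  stack-beyond X zero    i cs       x B       ne = stack-≥ i cs x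
  stack-beyond X (suc k) i []       x B       ne = []
  stack-beyond X (suc k) i (c ∷ cs) x (e , B) ne rewrite ≡ᵇ-false (peg i c) x (λ e' → ne (trans (sym e') e)) =
    subst (λ z → All (z ≤_) (stack (suc i) cs x)) (+-suc k i) (stack-beyond X k (suc i) cs x B ne)

  stack-top : ∀ X k i cs Y → Tower X i k cs → k < length cs → peg (k + i) (nth k cs) ≡ Y → Y ≢ X →
              ∃[ r ] stack i cs Y ≡ (k + i) ∷ r
  stack-top X zero i (c ∷ cs) Y B lt e ne rewrite ≡ᵇ-true _ _ e = _ , refl
  stack-top X (suc k) i (c ∷ cs) Y (e , B) (s≤s lt) eY ne rewrite ≡ᵇ-false (peg i c) Y (λ e' → ne (trans (sym e') e))
    with stack-top X k (suc i) cs Y B lt (trans (cong (λ z → peg z (nth k cs)) (+-suc k i)) eY) ne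
  ... | r , eq = r , trans eq (cong (_∷ r) (+-suc k i))

  stack-empty : ∀ X i cs x → Tower X i (length cs) cs → x ≢ X → stack i cs x ≡ []
  stack-empty X i []       x B       ne = refl
  stack-empty X i (c ∷ cs) x (e , B) ne rewrite ≡ᵇ-false (peg i c) x (λ e' → ne (trans (sym e') e)) =
    stack-empty X (suc i) cs x B ne

  D₁-on-its-peg : ∀ c cs → mem 1 (stack 1 (c ∷ cs) (peg 1 c)) ≡ true
  D₁-on-its-peg c cs = trans (mem-stack 0 1 (c ∷ cs) (peg 1 c) 1 refl (s≤s z≤n)) (≡ᵇ-true (peg 1 c) (peg 1 c) refl)

  topNoD1-tower : ∀ c cs x → x ≡ peg 1 c → topNoD1 (stack 1 (c ∷ cs) x) ≡ []
  topNoD1-tower c cs x refl = topNoD1-D1 (stack 1 (c ∷ cs) (peg 1 c)) (D₁-on-its-peg c cs)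

  smallestTop-config : ∀ X cs k → suc k < length cs → Tower X 1 (suc k) cs →
                       peg (suc (suc k)) (nth (suc k) cs) ≢ X → smallestTop (config cs) ≡ just (suc (suc k))
  smallestTop-config X (c ∷ cs) k lt B@(D₁-on-X , _) ne =
    minM-least (tops (tabulate g)) (suc (suc k)) lower-bound candidate
    where
      g : Fin M → List ℕ
      g p = stack 1 (c ∷ cs) (toℕ p)
      d = suc (suc k)
      d≡ : suc k + 1 ≡ d
      d≡ = +-comm (suc k) 1
      beyond : ∀ x → x ≢ X → All (d ≤_) (stack 1 (c ∷ cs) x)
      beyond x ne' = subst (λ z → All (z ≤_) (stack 1 (c ∷ cs) x)) d≡ (stack-beyond X (suc k) 1 (c ∷ cs) x B ne')
      lower-bound : All (d ≤_) (tops (tabulate g))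
      lower-bound = tops-All g (d ≤_) bound
        where
          bound : ∀ p → All (d ≤_) (topNoD1 (g p))
          bound p with toℕ p ≟ X
          ... | yes p≡X = subst (All (d ≤_)) (sym (topNoD1-tower c cs (toℕ p) (trans p≡X (sym D₁-on-X)))) []
          ... | no p≢X  = topNoD1-All _ _ (beyond (toℕ p) p≢X)
      Y  = peg d (nth (suc k) (c ∷ cs))
      PY = fromℕ< (peg-< d (nth (suc k) (c ∷ cs)))
      candidate : d ∈ tops (tabulate g)
      candidate with stack-top X (suc k) 1 (c ∷ cs) Y B lt (cong (λ z → peg z (nth (suc k) (c ∷ cs))) d≡) ne
      ... | r , top = tops-∈ g d PY on-top
        where
          on-top : d ∈ topNoD1 (g PY)
          on-top rewrite toℕ-fromℕ< (peg-< d (nth (suc k) (c ∷ cs))) | top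
               | mem-absent 1 (suc k + 1 ∷ r)
                   (subst (All (1 <_)) top (All.map (≤-trans (s≤s (s≤s z≤n))) (beyond Y ne))) = here (sym d≡)

  smallestTop-finished : ∀ X cs → Tower X 1 (length cs) cs → smallestTop (config cs) ≡ nothing
  smallestTop-finished X cs B = cong minM (tops-empty {L = M} (λ p → stack 1 cs (toℕ p)) (no-candidate cs B))
    where
      no-candidate : ∀ cs → Tower X 1 (length cs) cs → ∀ p → topNoD1 (stack 1 cs (toℕ p)) ≡ []
      no-candidate cs B p with toℕ p ≟ X
      no-candidate []        B         p | yes p≡X = refl
      no-candidate (c ∷ cs') (e₀ , _) p | yes p≡X = topNoD1-tower c cs' (toℕ p) (trans p≡X (sym e₀))
      no-candidate cs        B         p | no p≢X rewrite stack-empty X 1 cs (toℕ p) B p≢X = refl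

digit-sum-rearrange : ∀ m1 x s → x + s * suc m1 ≡ s + (x + s * m1)
digit-sum-rearrange = solve-∀

same-peg-rearrange : ∀ m b a → b * m + (a + b) ≡ a + b * suc m
same-peg-rearrange = solve-∀

pair-sum-rearrange : ∀ m1 x x' s' t →
  (x + (x' + s' * suc m1) * m1) + (t + (x' + s' * m1)) ≡ (t + (x + x' * suc m1)) + (s' * m1) * suc (suc m1)
pair-sum-rearrange = solve-∀

gap-rearrange : ∀ t x e → t + (suc (x + e) + x * suc (suc (x + e))) ≡ (t + suc e) + x * suc (suc (suc (x + e)))
gap-rearrange = solve-∀

module Counting (m2 : ℕ) where
  open Pegs m2
  open Selection m2

  -- counts n t = (c₁,…,cₙ) with cᵢ = tᵢ − tᵢ₊₁ where tᵢ = ⌊t / mⁱ⁻¹⌋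
  counts : ℕ → ℕ → List ℕ
  counts zero    t = []
  counts (suc n) t = (t ∸ t / m) ∷ counts n (t / m)

  length-counts : ∀ n t → length (counts n t) ≡ n
  length-counts zero    t = refl
  length-counts (suc n) t = cong suc (length-counts n (t / m))

  /-digit : ∀ x s → x < m → (x + s * m) / m ≡ s
  /-digit x s x<m = trans (+-distrib-/-∣ʳ x (n∣m*n s)) (cong₂ _+_ (m<n⇒m/n≡0 x<m) (m*n/n≡m s m))

  %-digit : ∀ x s → x < m → (x + s * m) % m ≡ x
  %-digit x s x<m = trans ([m+kn]%n≡m%n x s m) (m<n⇒m%n≡m x<m)

  first-count : ∀ x s → x + s * m ∸ s ≡ x + s * m1
  first-count x s = trans (cong (_∸ s) (digit-sum-rearrange m1 x s)) (m+n∸m≡n s (x + s * m1))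

  counts-digit : ∀ n x s → x < m → counts (suc n) (x + s * m) ≡ (x + s * m1) ∷ counts n s
  counts-digit n x s lt =
    cong₂ _∷_ (trans (cong ((x + s * m) ∸_) (/-digit x s lt)) (first-count x s)) (cong (counts n) (/-digit x s lt))

  first-count-div : ∀ t → t ∸ t / m ≡ t % m + (t / m) * m1
  first-count-div t = trans (cong (_∸ t / m) (m≡m%n+[m/n]*n t m)) (first-count (t % m) (t / m))

  TrailingMax : ℕ → ℕ → Set
  TrailingMax t zero    = t % m < m1
  TrailingMax t (suc k) = t % m ≡ m1 × TrailingMax (t / m) k

  AllMax : ℕ → ℕ → Set
  AllMax t zero    = ⊤
  AllMax t (suc n) = t % m ≡ m1 × AllMax (t / m) n

  AllMax-pow : ∀ n → AllMax (m ^ n ∸ 1) n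
  AllMax-pow zero = tt
  AllMax-pow (suc n) with m ^ n | m^n>0 m n | AllMax-pow n
  ... | suc p | _ | ih = subst (λ z → AllMax z (suc n)) (sym mmp)
        (%-digit m1 p ≤-refl , subst (λ z → AllMax z n) (sym (/-digit m1 p ≤-refl)) ih)
    where
      mmp : m * suc p ∸ 1 ≡ m1 + p * m
      mmp = trans (cong (_∸ 1) (*-suc m p)) (cong (m1 +_) (*-comm m p))

  counts-step : ∀ n t → suc t < m ^ n → ∃[ k ] (k < n × counts n (suc t) ≡ modifyAt k suc (counts n t) × TrailingMax t k)
  counts-step zero    t (s≤s ())
  counts-step (suc n) t lt with t % m <? m1 | m≡m%n+[m/n]*n t m | m%n<n t m
  ... | yes x<m1 | t≡ | _ = 0 , s≤s z≤n , cong₂ _∷_ first rest , x<m1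
    where
      1+t≡ : suc t ≡ suc (t % m) + (t / m) * m
      1+t≡ = cong suc t≡
      quot≡ : suc t / m ≡ t / m
      quot≡ = trans (cong (_/ m) 1+t≡) (/-digit (suc (t % m)) (t / m) (s≤s x<m1))
      rem≡ : suc t % m ≡ suc (t % m)
      rem≡ = trans (cong (_% m) 1+t≡) (%-digit (suc (t % m)) (t / m) (s≤s x<m1))
      first : suc t ∸ suc t / m ≡ suc (t ∸ t / m)
      first = trans (first-count-div (suc t)) (trans (cong₂ (λ a b → a + b * m1) rem≡ quot≡) (cong suc (sym (first-count-div t))))
      rest : counts n (suc t / m) ≡ counts n (t / m)
      rest = cong (counts n) quot≡
  ... | no x≮m1 | t≡ | x<m = suc k , s≤s k<n , cong₂ _∷_ first rest , (x≡m1 , trailing)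
    where
      x≡m1 : t % m ≡ m1
      x≡m1 = ≤-antisym (s≤s⁻¹ x<m) (≮⇒≥ x≮m1)
      1+t≡ : suc t ≡ 0 + suc (t / m) * m
      1+t≡ = trans (cong suc t≡) (cong (λ z → suc z + (t / m) * m) x≡m1)
      quot≡ : suc t / m ≡ suc (t / m)
      quot≡ = trans (cong (_/ m) 1+t≡) (/-digit 0 (suc (t / m)) (s≤s z≤n))
      rem≡ : suc t % m ≡ 0
      rem≡ = trans (cong (_% m) 1+t≡) (%-digit 0 (suc (t / m)) (s≤s z≤n))
      first : suc t ∸ suc t / m ≡ t ∸ t / m
      first = trans (first-count-div (suc t))
                (trans (cong₂ (λ a b → a + b * m1) rem≡ quot≡) (trans (cong (_+ (t / m) * m1) (sym x≡m1)) (sym (first-count-div t))))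
      lt' : suc (t / m) < m ^ n
      lt' = *-cancelʳ-< m (suc (t / m)) (m ^ n) (subst₂ _<_ 1+t≡ (*-comm m (m ^ n)) lt)
      IH = counts-step n (t / m) lt'
      k = proj₁ IH
      k<n = proj₁ (proj₂ IH)
      trailing = proj₂ (proj₂ (proj₂ IH))
      rest : counts n (suc t / m) ≡ modifyAt k suc (counts n (t / m))
      rest = trans (cong (counts n) quot≡) (proj₁ (proj₂ (proj₂ IH)))

  -- Disk i after a moves and disk i+1 after b moves share a peg exactly
  -- when a + b ≡ 0 modulo M (they walk in opposite directions).

  sum≡0⇒same-residue : ∀ a b → (a + b) % M ≡ 0 → a % M ≡ (b * m) % M
  sum≡0⇒same-residue a b e = sym (begin
      (b * m) % M            ≡⟨ %-remove-+ʳ (b * m) (m%n≡0⇒n∣m (a + b) M e) ⟨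
      (b * m + (a + b)) % M  ≡⟨ cong (_% M) (same-peg-rearrange m b a) ⟩
      (a + b * M) % M        ≡⟨ [m+kn]%n≡m%n a b M ⟩
      a % M                  ∎)
    where open ≡-Reasoning

  same-residue⇒sum≡0 : ∀ a b → a % M ≡ (b * m) % M → (a + b) % M ≡ 0
  same-residue⇒sum≡0 a b e = begin
      (a + b) % M              ≡⟨ %-absorbˡ a b ⟨
      (a % M + b) % M          ≡⟨ cong (λ z → (z + b) % M) e ⟩
      ((b * m) % M + b) % M    ≡⟨ %-absorbˡ (b * m) b ⟩
      (b * m + b) % M          ≡⟨ cong (_% M) (trans (+-comm (b * m) b) (sym (*-suc b m))) ⟩
      (b * M) % M              ≡⟨ m*n%n≡0 b M ⟩
      0                        ∎
    where open ≡-Reasoning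

  same-peg : ∀ i a b → (a + b) % M ≡ 0 → peg i a ≡ peg (suc i) b
  same-peg i a b e with isOdd i
  ... | true  = sum≡0⇒same-residue a b e
  ... | false = sym (sum≡0⇒same-residue b a (trans (cong (_% M) (+-comm b a)) e))

  different-peg : ∀ i a b → (a + b) % M ≢ 0 → peg i a ≢ peg (suc i) b
  different-peg i a b ne eq with isOdd i
  ... | true  = ne (same-residue⇒sum≡0 a b eq)
  ... | false = ne (trans (cong (_% M) (+-comm a b)) (same-residue⇒sum≡0 b a (sym eq)))

  -- The sum of two adjacent counts modulo M, in terms of two base-m digits
  -- x, x' of t (the second count offset by u).
  adjacent-sum : ∀ t u → ((t ∸ t / m) + (u + (t / m ∸ t / m / m))) % M ≡ (u + (t % m + (t / m) % m * m)) % M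
  adjacent-sum t u = trans (cong (_% M) rearranged) ([m+kn]%n≡m%n (u + (t % m + (t / m) % m * m)) ((t / m / m) * m1) M)
    where
      rearranged = trans (cong₂ (λ a b → a + (u + b))
                                (trans (first-count-div t) (cong (λ z → t % m + z * m1) (m≡m%n+[m/n]*n (t / m) m)))
                                (first-count-div (t / m)))
                         (pair-sum-rearrange m1 (t % m) ((t / m) % m) (t / m / m) u)

  -- two trailing digits m−1: adjacent disks share a peg
  adjacent-sum-max : ∀ t → t % m ≡ m1 → (t / m) % m ≡ m1 → ((t ∸ t / m) + (0 + (t / m ∸ t / m / m))) % M ≡ 0
  adjacent-sum-max t e1 e2 rewrite adjacent-sum t 0 | e1 | e2 = trans (cong (_% M) (sym (*-suc m1 m))) (m*n%n≡0 m1 M)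

  -- digit m−1 followed by a smaller digit: the two disks are on different
  -- pegs, also after the second one moves (u = 1)
  adjacent-sum-gap : ∀ t u → u ≤ 1 → t % m ≡ m1 → (t / m) % m < m1 →
                     ((t ∸ t / m) + (u + (t / m ∸ t / m / m))) % M ≢ 0
  adjacent-sum-gap t u u≤1 e1 lt rewrite adjacent-sum t u | e1 = λ z → 0≢1+n (begin
      0                              ≡⟨ z ⟨
      (u + (m1 + x' * m)) % M        ≡⟨ cong (λ w → (u + (w + x' * suc w)) % M) m1≡ ⟩
      (u + (suc (x' + e) + x' * suc (suc (x' + e)))) % M
                                     ≡⟨ cong (_% M) (gap-rearrange u x' e) ⟩
      (u + suc e + x' * suc (suc (suc (x' + e)))) % M
                                     ≡⟨ cong (λ w → (u + suc e + x' * suc (suc w)) % M) (sym m1≡) ⟩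
      (u + suc e + x' * M) % M       ≡⟨ [m+kn]%n≡m%n (u + suc e) x' M ⟩
      (u + suc e) % M                ≡⟨ m<n⇒m%n≡m bound ⟩
      u + suc e                      ≡⟨ +-suc u e ⟩
      suc (u + e)                    ∎)
    where
      open ≡-Reasoning
      x' = (t / m) % m
      e  = m1 ∸ suc x'
      m1≡ : m1 ≡ suc (x' + e)
      m1≡ = sym (m+[n∸m]≡n lt)
      bound : u + suc e < M
      bound = s≤s (+-mono-≤ u≤1 (subst (suc e ≤_) (sym m1≡) (s≤s (m≤n+m e x'))))

  tower-below : ∀ k n t i → suc k < n → TrailingMax t (suc k) →
    Tower (peg i (t ∸ t / m)) i (suc k) (counts n t)
    × peg (suc k + i) (nth (suc k) (counts n t)) ≢ peg i (t ∸ t / m)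
    × peg (suc k + i) (suc (nth (suc k) (counts n t))) ≢ peg i (t ∸ t / m)
  tower-below zero (suc zero) t i (s≤s ()) _
  tower-below zero (suc (suc n)) t i lt (x≡ , x'<) =
    (refl , tt) ,
    (λ e → different-peg i (t ∸ t / m) (t / m ∸ t / m / m) (adjacent-sum-gap t 0 z≤n x≡ x'<) (sym e)) ,
    (λ e → different-peg i (t ∸ t / m) (suc (t / m ∸ t / m / m)) (adjacent-sum-gap t 1 ≤-refl x≡ x'<) (sym e))
  tower-below (suc k) (suc (suc n)) t i (s≤s lt) (x≡ , (x'≡ , trailing))
    with tower-below k (suc n) (t / m) (suc i) lt (x'≡ , trailing)
  ... | B , off , off' =
      (refl , Prefix-map (λ e c p → trans p same) (suc i) (suc k) (counts (suc n) (t / m)) B) ,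
      (λ e → off  (trans (cong (λ z → peg z (nth (suc k) (counts (suc n) (t / m)))) (+-suc (suc k) i)) (trans e (sym same)))) ,
      (λ e → off' (trans (cong (λ z → peg z (suc (nth (suc k) (counts (suc n) (t / m))))) (+-suc (suc k) i)) (trans e (sym same))))
    where
      same : peg (suc i) (t / m ∸ t / m / m) ≡ peg i (t ∸ t / m)
      same = sym (same-peg i (t ∸ t / m) (t / m ∸ t / m / m) (adjacent-sum-max t x≡ x'≡))

  tower-all : ∀ n t i → AllMax t n → Tower (peg i (nth 0 (counts n t))) i n (counts n t)
  tower-all zero          t i d = tt
  tower-all (suc zero)    t i d = refl , tt
  tower-all (suc (suc n)) t i (x≡ , (x'≡ , d)) =
    refl , Prefix-map (λ e c p → trans p same) (suc i) (suc n) (counts (suc n) (t / m))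
                      (tower-all (suc n) (t / m) (suc i) (x'≡ , d))
    where
      same : peg (suc i) (t / m ∸ t / m / m) ≡ peg i (t ∸ t / m)
      same = sym (same-peg i (t ∸ t / m) (t / m ∸ t / m / m) (adjacent-sum-max t x≡ x'≡))

module Digits (m2 : ℕ) where
  open Pegs m2
  open Counting m2

  digit-up : ∀ x → x ≤ m1 → digit x ≡ (x , not (x ≡ᵇ m1))
  digit-up zero    _  = refl
  digit-up (suc x) le rewrite digit-up x (≤-trans (n≤1+n x) le) | ≡ᵇ-false x m1 (λ e → <-irrefl e le)
    with suc x ≡ᵇ m1
  ... | true  = refl
  ... | false = refl

  digit-down : ∀ x → x ≤ m1 → fold (m1 , false) (nextDigit m) x ≡ (m1 ∸ x , (x ≡ᵇ m1))
  digit-down zero    _  = refl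
  digit-down (suc x) le rewrite digit-down x (≤-trans (n≤1+n x) le) | ≡ᵇ-false x m1 (λ e → <-irrefl e le)
    with suc x ≟ m1
  ... | yes e rewrite ≡ᵇ-true (m1 ∸ x) 1 (trans (cong (_∸ x) (sym e)) (m+n∸n≡m 1 x)) | ≡ᵇ-true (suc x) m1 e =
        cong (_, true) (sym (trans (cong (_∸ suc x) (sym e)) (n∸n≡0 (suc x))))
  ... | no ne rewrite ≡ᵇ-false (m1 ∸ x) 1 (λ e → ne (sym (trans (sym (m∸n+n≡m (≤-trans (n≤1+n x) le))) (cong (_+ x) e))))
                    | ≡ᵇ-false (suc x) m1 ne =
        cong (_, false) (trans (∸-+-assoc m1 x 1) (cong (m1 ∸_) (+-comm x 1)))

  -- the sequence has period 2(m−1): after s half-periods it is at an end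
  digit-half-periods : ∀ s → digit (s * m1) ≡ (if isOdd s then (m1 , false) else (0 , true))
  digit-half-periods zero = refl
  digit-half-periods (suc s) rewrite fold-+ (0 , true) (nextDigit m) m1 {s * m1} | digit-half-periods s with isOdd s
  ... | false rewrite digit-up m1 ≤-refl | ≡ᵇ-true m1 m1 refl = refl
  ... | true  rewrite digit-down m1 ≤-refl | ≡ᵇ-true m1 m1 refl | n∸n≡0 m1 = refl

  digit-value : ∀ x s → x ≤ m1 → proj₁ (digit (x + s * m1)) ≡ (if isOdd s then m1 ∸ x else x)
  digit-value x s le rewrite fold-+ (0 , true) (nextDigit m) x {s * m1} | digit-half-periods s with isOdd s
  ... | true  = cong proj₁ (digit-down x le)
  ... | false = cong proj₁ (digit-up x le)

  tupleAt : ℕ → ℕ → List ℕ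
  tupleAt n t = tuple (config (counts n t))

  tupleAt-digit : ∀ n x s → x < m → tupleAt (suc n) (x + s * m) ≡ tupleAt n s ++ [ proj₁ (digit (x + s * m1)) ]
  tupleAt-digit n x s lt =
    trans (cong (λ cs → reverse (map proj₁ (map digit cs))) (counts-digit n x s lt))
          (unfold-reverse (proj₁ (digit (x + s * m1))) (map proj₁ (map digit (counts n s))))

  block-pointwise : ∀ n s l a → a + l ≤ m →
    map (λ x → tupleAt (suc n) (x + s * m)) (range a l)
    ≡ map (λ x → tupleAt n s ++ [ (if isOdd s then m1 ∸ x else x) ]) (range a l)
  block-pointwise n s zero    a le = refl
  block-pointwise n s (suc l) a le =
    cong₂ _∷_ (trans (tupleAt-digit n a s a<m) (cong (λ z → tupleAt n s ++ [ z ]) (digit-value a s (s≤s⁻¹ a<m))))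
              (block-pointwise n s l (suc a) (subst (_≤ m) (+-suc a l) le))
    where
      a<m : a < m
      a<m = ≤-trans (s≤s (m≤m+n a l)) (subst (_≤ m) (+-suc a l) le)

  gray-block : ∀ n s → map (λ x → tupleAt n s ++ [ x ]) (if not (isOdd s) then upTo m else reverse (upTo m))
                       ≡ map (tupleAt (suc n)) (range (s * m) m)
  gray-block n s = sym (trans (map-range-+ (tupleAt (suc n)) 0 (s * m) m)
                              (trans (block-pointwise n s m 0 ≤-refl) (digits-in-order (isOdd s))))
    where
      digits-in-order : ∀ b → map (λ x → tupleAt n s ++ [ (if b then m1 ∸ x else x) ]) (range 0 m)
                              ≡ map (λ x → tupleAt n s ++ [ x ]) (if not b then upTo m else reverse (upTo m))
      digits-in-order false = cong (map (λ x → tupleAt n s ++ [ x ])) (sym (upTo-range m))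
      digits-in-order true  = trans (map-∘ (range 0 m))
        (cong (map (λ x → tupleAt n s ++ [ x ])) (sym (trans (cong reverse (upTo-range m)) (reverse-range m1))))

  grayStep-tuples : ∀ n L s → grayStep m (not (isOdd s)) (map (tupleAt n) (range s L))
                              ≡ map (tupleAt (suc n)) (range (s * m) (L * m))
  grayStep-tuples n zero    s = refl
  grayStep-tuples n (suc L) s = begin
      grayStep m (not (isOdd s)) (map (tupleAt n) (range s (suc L)))
        ≡⟨ cong₂ _++_ (gray-block n s) (grayStep-tuples n L (suc s)) ⟩
      map (tupleAt (suc n)) (range (s * m) m) ++ map (tupleAt (suc n)) (range (suc s * m) (L * m))
        ≡⟨ map-++ (tupleAt (suc n)) (range (s * m) m) _ ⟨
      map (tupleAt (suc n)) (range (s * m) m ++ range (suc s * m) (L * m))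
        ≡⟨ cong (map (tupleAt (suc n))) (range-++ (s * m) m (L * m) (suc s * m) (+-comm m (s * m))) ⟩
      map (tupleAt (suc n)) (range (s * m) (suc L * m)) ∎
    where open ≡-Reasoning

  gray-tuples : ∀ n → G m n ≡ map (tupleAt n) (range 0 (m ^ n))
  gray-tuples zero = refl
  gray-tuples (suc n) rewrite gray-tuples n =
    trans (grayStep-tuples n (m ^ n) 0) (cong (λ z → map (tupleAt (suc n)) (range 0 z)) (*-comm (m ^ n) m))

-- The run of Algorithm EVEN with n = n1 + 1 disks: after t single moves the
-- state is `stateAt t`, and each round of the main loop covers m moves.
module Run (m2 n1 : ℕ) where
  open Pegs m2
  open Selection m2
  open Counting m2
  open Digits m2

  n = suc n1
  N = m ^ n1

  stateAt : ℕ → State m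
  stateAt t = config (counts n t)

  D₁-step : ∀ r j → r < m1 → moveDisk m 1 (stateAt (r + j * m)) ≡ stateAt (suc r + j * m)
  D₁-step r j lt = trans (move-config (counts n (r + j * m)) 0 (s≤s z≤n) tt)
    (cong config (trans (cong (modifyAt 0 suc) (counts-digit n1 r j (≤-trans lt (n≤1+n m1))))
                        (sym (counts-digit n1 (suc r) j (s≤s lt)))))

  D₁-moves : ∀ l r j → r + l ≤ m1 →
             moveD1s m l (stateAt (r + j * m)) ≡ (map (tupleAt n) (range (suc (r + j * m)) l) , stateAt (l + r + j * m))
  D₁-moves zero    r j le = refl
  D₁-moves (suc l) r j le
    rewrite D₁-step r j (≤-trans (s≤s (m≤m+n r l)) (subst (_≤ m1) (+-suc r l) le))
          | D₁-moves l (suc r) j (subst (_≤ m1) (+-suc r l) le) | +-suc l r = refl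

  round-end : ∀ j → suc (m1 + 0 + j * m) ≡ suc j * m
  round-end j = cong (λ z → suc (z + j * m)) (+-identityʳ m1)

  -- In the last round all digits are m−1 and the algorithm stops, …
  selection-finished : ∀ j → suc j ≡ N → smallestTop (stateAt (m1 + 0 + j * m)) ≡ nothing
  selection-finished j last =
    smallestTop-finished (peg 1 (nth 0 cs)) cs
      (subst (λ z → Tower (peg 1 (nth 0 cs)) 1 z cs) (sym (length-counts n t)) (tower-all n t 1 all-max))
    where
      t  = m1 + 0 + j * m
      cs = counts n t
      t+1≡ : suc t ≡ m ^ n
      t+1≡ = trans (round-end j) (trans (cong (_* m) last) (*-comm N m))
      all-max : AllMax t n
      all-max = subst (λ z → AllMax z n) (sym (cong pred t+1≡)) (AllMax-pow n)

  -- … while before it the selected disk performs move number (j+1)·m.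
  selection-continues : ∀ j → suc (m1 + 0 + j * m) < m ^ n →
    ∃[ k ] (smallestTop (stateAt (m1 + 0 + j * m)) ≡ just (suc (suc k))
            × moveDisk m (suc (suc k)) (stateAt (m1 + 0 + j * m)) ≡ stateAt (suc j * m))
  selection-continues j lt with counts-step n (m1 + 0 + j * m) lt
  ... | zero , _ , _ , last-digit = ⊥-elim (<-irrefl last-digit≡ last-digit)
    where
      last-digit≡ : (m1 + 0 + j * m) % m ≡ m1
      last-digit≡ = trans (cong (λ z → (z + j * m) % m) (+-identityʳ m1)) (%-digit m1 j ≤-refl)
  ... | suc k , k<n , step , trailing with tower-below k n (m1 + 0 + j * m) 1 k<n trailing
  ... | B , off , off' = k , selected , moved
    where
      t  = m1 + 0 + j * m
      cs = counts n t
      a  = nth (suc k) cs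
      d≡ : suc k + 1 ≡ suc (suc k)
      d≡ = +-comm (suc k) 1
      k<len : suc k < length cs
      k<len = subst (suc k <_) (sym (length-counts n t)) k<n
      selected = smallestTop-config _ cs k k<len B (λ e → off (trans (cong (λ z → peg z a) d≡) e))
      off-after : peg (suc (suc k)) (suc a) ≢ peg 1 (t ∸ t / m)
      off-after e = off' (trans (cong (λ z → peg z (suc a)) d≡) e)
      target-free = Prefix-map (λ e c p q → off-after (trans (sym q) p)) 1 (suc k) cs B
      moved = trans (move-config cs (suc k) k<len target-free) (trans (cong config (sym step)) (cong stateAt (round-end j)))

  not-last : ∀ r j → suc (j + suc r) ≡ N → suc (m1 + 0 + j * m) < m ^ n
  not-last r j rounds = subst₂ _<_ (sym (round-end j)) (*-comm N m) (*-monoˡ-< m j+1<N)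
    where
      j+1<N : suc j < N
      j+1<N = subst (suc j <_) rounds (s≤s (subst (suc j ≤_) (sym (+-suc j r)) (s≤s (m≤m+n j r))))

  run-rounds : ∀ r j → suc (j + r) ≡ N →
               runEVEN m (suc r) (stateAt (j * m)) ≡ just (map (tupleAt n) (range (suc (j * m)) (m1 + r * m)))
  run-rounds zero j rounds =
    trans (runEVEN-stop m 0 (stateAt (j * m)) _ _ (D₁-moves m1 0 j ≤-refl)
                        (selection-finished j (trans (cong suc (sym (+-identityʳ j))) rounds)))
          (cong just (cong (λ z → map (tupleAt n) (range (suc (j * m)) z)) (sym (+-identityʳ m1))))
  run-rounds (suc r) j rounds with selection-continues j (not-last r j rounds)
  ... | k , selected , moved = begin
      runEVEN m (suc (suc r)) (stateAt (j * m))
        ≡⟨ runEVEN-step m (suc r) (stateAt (j * m)) _ _ (suc (suc k)) (D₁-moves m1 0 j ≤-refl) selected ⟩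
      M.map (λ rest → ts₁ ++ (tuple s₂ ∷ rest)) (runEVEN m (suc r) s₂)
        ≡⟨ cong₂ (λ s z → M.map (λ rest → ts₁ ++ (tuple s ∷ rest)) z) moved
                 (trans (cong (runEVEN m (suc r)) moved) (run-rounds r (suc j) (trans (cong suc (sym (+-suc j r))) rounds))) ⟩
      just (ts₁ ++ map (tupleAt n) (range (suc j * m) (suc (m1 + r * m))))
        ≡⟨ cong just (sym (map-++ (tupleAt n) (range (suc (j * m)) m1) (range (suc j * m) (suc (m1 + r * m))))) ⟩
      just (map (tupleAt n) (range (suc (j * m)) m1 ++ range (suc j * m) (suc (m1 + r * m))))
        ≡⟨ cong (just ∘ map (tupleAt n)) (range-++ (suc (j * m)) m1 (suc (m1 + r * m)) (suc j * m) (cong suc (+-comm m1 (j * m)))) ⟩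
      just (map (tupleAt n) (range (suc (j * m)) (m1 + suc (m1 + r * m)))) ∎
    where
      open ≡-Reasoning
      ts₁ = map (tupleAt n) (range (suc (j * m)) m1)
      s₂  = moveDisk m (suc (suc k)) (stateAt (m1 + 0 + j * m))

  peg-initial : ∀ i → peg i 0 ≡ 0
  peg-initial i with isOdd i
  ... | true  = refl
  ... | false = refl

  stack-initial-0 : ∀ i k → stack i (replicate k 0) 0 ≡ range i k
  stack-initial-0 i zero    = refl
  stack-initial-0 i (suc k) rewrite peg-initial i = cong (i ∷_) (stack-initial-0 (suc i) k)

  stack-initial-suc : ∀ i k x → stack i (replicate k 0) (suc x) ≡ []
  stack-initial-suc i zero    x = refl
  stack-initial-suc i (suc k) x rewrite peg-initial i = stack-initial-suc (suc i) k x

  counts-initial : ∀ k → counts k 0 ≡ replicate k 0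
  counts-initial zero    = refl
  counts-initial (suc k) = cong (0 ∷_) (counts-initial k)

  initState-config : initState m n ≡ stateAt 0
  initState-config = trans (cong₂ st (cong₂ _∷_ peg₀ other-pegs) (sym digits₀)) (cong config (sym (counts-initial n)))
    where
      peg₀ : applyUpTo suc n ≡ stack 1 (replicate n 0) 0
      peg₀ = begin
        applyUpTo suc n           ≡⟨ applyUpTo-range suc n ⟩
        map suc (range 0 n)       ≡⟨ map-range-suc (λ x → x) 0 n ⟨
        map (λ x → x) (range 1 n) ≡⟨ map-id (range 1 n) ⟩
        range 1 n                 ≡⟨ stack-initial-0 1 n ⟨
        stack 1 (replicate n 0) 0 ∎
        where open ≡-Reasoning
      other-pegs : V.replicate m [] ≡ tabulate (λ p → stack 1 (replicate n 0) (suc (toℕ p)))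
      other-pegs = sym (tabulate-constant [] _ (λ p → stack-initial-suc 1 n (toℕ p)))
      digits₀ : ∀ {k} → map digit (replicate k 0) ≡ replicate k (0 , true)
      digits₀ {zero}  = refl
      digits₀ {suc k} = cong ((0 , true) ∷_) (digits₀ {k})

  trace-is-gray : ∀ r → suc r ≡ N → traceEVEN m n (suc r) ≡ just (G m n)
  trace-is-gray r rounds = begin
      M.map (tuple (initState m n) ∷_) (runEVEN m (suc r) (initState m n))
        ≡⟨ cong (λ s → M.map (tuple s ∷_) (runEVEN m (suc r) s)) initState-config ⟩
      M.map (tuple (stateAt 0) ∷_) (runEVEN m (suc r) (stateAt 0))
        ≡⟨ cong (M.map (tuple (stateAt 0) ∷_)) (run-rounds r 0 rounds) ⟩
      just (map (tupleAt n) (range 0 (suc r * m)))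
        ≡⟨ cong (λ z → just (map (tupleAt n) (range 0 z))) (trans (cong (_* m) rounds) (*-comm N m)) ⟩
      just (map (tupleAt n) (range 0 (m ^ n)))
        ≡⟨ cong just (gray-tuples n) ⟨
      just (G m n) ∎
    where open ≡-Reasoning

theorem2 : (m n : ℕ) → 2 ≤ m → 2 ∣ m → 1 ≤ n →
    ∃[ fuel ] traceEVEN m n fuel ≡ just (G m n)
theorem2 m@(suc (suc m2)) (suc n1) (s≤s (s≤s z≤n)) _ (s≤s z≤n) =
  N , subst (λ fuel → traceEVEN m n fuel ≡ just (G m n)) enough (trace-is-gray (pred N) enough)
  where
    open Run m2 n1
    enough : suc (pred N) ≡ N
    enough = suc-pred N {{m^n≢0 m n1}}
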